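{- Let $\mathfrak A$ be a model of the sentence $\Phi$ described in the context, and let $(a_l)_{l\in\mathbb Z}$ be a quasi-chain in $\mathfrak A$ with $a_0<a_2$. Then for all $l,m\in\mathbb Z$ with $l+2\le m$ we have $a_l<a_m$.
   Context: The signature is $\{<,A_0,A_1,A_2,A_3,A_4\}$ with $A_i$ unary and $<$ binary, interpreted as a strict partial order. Write $x\sim y$ for $x\neq y\wedge\neg(x<y)\wedge\neg(y<x)$. Indices of the $A_i$ are taken modulo $5$, with $\oplus,\ominus$ addition and subtraction mod 5. $\Phi$ is the conjunction of: (1) $\forall x\,\dot\bigvee_{i=0}^4A_ix$ (exactly one $A_i$ holds); (2) for each $i\in\{0,\dots,4\}$: $\forall x\forall y\,(A_ix\wedge A_iy\wedge x\neq y)\rightarrow(x>y\vee y>x)$; (3) for each $i\in\{0,1,2\}$ and $j\in\{i+2,i+3\}$ (mod 5): $\forall x\forall y\,(A_ix\wedge A_jy)\rightarrow(x>y\vee y>x)$; (4) for each $i$: $\forall x\,A_ix\rightarrow[\exists y\,(A_{i\oplus1}y\wedge x\sim y)\wedge\exists y\,(A_{i\ominus1}y\wedge x\sim y)]$. If $a\in A_i$, an element $b\in A_{i\oplus1}$ with $a\sim b$ is called a right-witness of $a$. A sequence $(a_l)_{l\in\mathbb Z}$ of elements is a quasi-chain if for every $l$, $a_{l+1}$ is a right-witness of $a_l$. -}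

module Defs where

open import Level using (Level; _⊔_) renaming (suc to lsuc)
open import Data.Fin using (Fin; toℕ; fromℕ<; inject≤)
open import Data.Nat.DivMod using (m%n<n)
open import Data.Nat using (ℕ)
import Data.Nat as ℕ
open import Data.Integer using (ℤ; _+_; _≤_; +_)
open import Data.Product using (Σ; _×_; _,_; ∃-syntax)
open import Data.Sum using (_⊎_)
open import Relation.Nullary using (¬_)
open import Relation.Binary.PropositionalEquality using (_≡_; _≢_)

_⊕_ : Fin 5 → ℕ → Fin 5
i ⊕ k = fromℕ< (m%n<n (toℕ i ℕ.+ k) 5)

succ5 : Fin 5 → Fin 5
succ5 i = i ⊕ 1

pred5 : Fin 5 → Fin 5
pred5 i = i ⊕ 4

record Structure (c ℓ : Level) : Set (lsuc (c ⊔ ℓ)) where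
  field
    Carrier : Set c
    _<_     : Carrier → Carrier → Set ℓ
    A       : Fin 5 → Carrier → Set ℓ
    irrefl  : ∀ {x} → ¬ (x < x)
    trans   : ∀ {x y z} → x < y → y < z → x < z

  _∼_ : Carrier → Carrier → Set (c ⊔ ℓ)
  x ∼ y = (x ≢ y) × (¬ (x < y)) × (¬ (y < x))

  Comparable : Carrier → Carrier → Set ℓ
  Comparable x y = (y < x) ⊎ (x < y)

  Ax1 : Set (c ⊔ ℓ)
  Ax1 = ∀ x → Σ (Fin 5) λ i → A i x × (∀ j → A j x → j ≡ i)

  Ax2 : Set (c ⊔ ℓ)
  Ax2 = ∀ i x y → A i x → A i y → x ≢ y → Comparable x y

  Ax3 : Set (c ⊔ ℓ)
  Ax3 = ∀ (i : Fin 3) (j : Fin 5) → (j ≡ (inject≤ i 3≤5 ⊕ 2) ⊎ j ≡ (inject≤ i 3≤5 ⊕ 3))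
        → ∀ x y → A (inject≤ i 3≤5) x → A j y → Comparable x y
    where
      3≤5 : 3 ℕ.≤ 5
      3≤5 = ℕ.s≤s (ℕ.s≤s (ℕ.s≤s ℕ.z≤n))

  Ax4 : Set (c ⊔ ℓ)
  Ax4 = ∀ i x → A i x → (∃[ y ] (A (succ5 i) y × x ∼ y)) × (∃[ y ] (A (pred5 i) y × x ∼ y))

  ModelΦ : Set (c ⊔ ℓ)
  ModelΦ = Ax1 × Ax2 × Ax3 × Ax4

  RightWitness : Carrier → Carrier → Set (c ⊔ ℓ)
  RightWitness a b = Σ (Fin 5) λ i → A i a × A (succ5 i) b × a ∼ b

  QuasiChain : (ℤ → Carrier) → Set (c ⊔ ℓ)
  QuasiChain a = ∀ l → RightWitness (a l) (a (l + + 1))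

module Submission where

open import Defs
open import Data.Integer using (ℤ; _+_; _-_; _≤_; +_; -[1+_]; ∣_∣)
open import Data.Integer.Properties using (+-assoc; +-identityʳ; i≤j⇒0≤j-i; 0≤i⇒+∣i∣≡i)
open import Data.Integer.Tactic.RingSolver using (solve-∀)
open import Data.Nat using (ℕ; zero; suc)
import Data.Nat.Properties as ℕ
open import Data.Fin using (zero; suc)
open import Data.Product using (_,_; proj₁; proj₂)
open import Data.Sum using (inj₁; inj₂; swap)
open import Relation.Nullary using (¬_; contradiction)
open import Relation.Binary.PropositionalEquality using (_≡_; refl; sym; trans; subst; cong; module ≡-Reasoning)

-- Consecutive terms of a quasi-chain are incomparable, while terms at distance 2 or 3 lie in
-- non-adjacent classes and are therefore comparable. If a_l < a_{l+2} but a_{l+3} < a_{l+1},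
-- then comparing a_l with a_{l+3} makes a_l < a_{l+1} or a_{l+3} < a_{l+2}; so all distance-2
-- comparisons point the same way, forwards and backwards along ℤ. The distance-3 comparisons
-- then follow suit, and every gap ≥ 2 is a sum of 2's and at most one 3.

infix 10 _⁺
infixl 9 _⁺^_

_⁺ : ℤ → ℤ
l ⁺ = l + + 1

_⁺^_ : ℤ → ℕ → ℤ
l ⁺^ zero  = l
l ⁺^ suc n = (l ⁺) ⁺^ n

⁺^≡+ : ∀ l n → l ⁺^ n ≡ l + + n
⁺^≡+ l zero    = sym (+-identityʳ l)
⁺^≡+ l (suc n) = trans (⁺^≡+ (l ⁺) n) (+-assoc l (+ 1) (+ n))

i≤j⇒i+∣j-i∣≡j : ∀ {i j} → i ≤ j → i + + ∣ j - i ∣ ≡ j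
i≤j⇒i+∣j-i∣≡j {i} {j} i≤j = begin
  i + + ∣ j - i ∣ ≡⟨ cong (_+_ i) (0≤i⇒+∣i∣≡i (i≤j⇒0≤j-i i≤j)) ⟩
  i + (j - i)     ≡⟨ i+[j-i]≡j i j ⟩
  j               ∎
  where
  open ≡-Reasoning
  i+[j-i]≡j : ∀ i j → i + (j - i) ≡ j
  i+[j-i]≡j = solve-∀

⁺-invariant⇒universal : ∀ {p} (P : ℤ → Set p) →
                        (∀ l → P l → P (l ⁺)) → (∀ l → P (l ⁺) → P l) →
                        P (+ 0) → ∀ l → P l
⁺-invariant⇒universal P up down P0 = universal
  where
  nonneg : ∀ n → P (+ n)
  nonneg zero    = P0
  nonneg (suc n) = subst P (cong +_ (ℕ.+-comm n 1)) (up (+ n) (nonneg n))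

  neg : ∀ n → P -[1+ n ]
  neg zero    = down -[1+ 0 ] P0
  neg (suc n) = down -[1+ suc n ] (neg n)

  universal : ∀ l → P l
  universal (+ n)    = nonneg n
  universal -[1+ n ] = neg n

module _ {c ℓ} (𝔄 : Structure c ℓ) where
  open Structure 𝔄 renaming (trans to <-trans)

  ∼⇒≮ : ∀ {x y} → x ∼ y → ¬ (x < y)
  ∼⇒≮ x∼y = proj₁ (proj₂ x∼y)

  ∼⇒≯ : ∀ {x y} → x ∼ y → ¬ (y < x)
  ∼⇒≯ x∼y = proj₂ (proj₂ x∼y)

  module _ (x : ℤ → Carrier)
           (∼-step : ∀ l → x l ∼ x (l ⁺))
           (comparable-2 : ∀ l → Comparable (x l) (x (l ⁺ ⁺)))
           (comparable-3 : ∀ l → Comparable (x l) (x (l ⁺ ⁺ ⁺))) where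

    <-2-forward : ∀ l → x l < x (l ⁺ ⁺) → x (l ⁺) < x (l ⁺ ⁺ ⁺)
    <-2-forward l p with comparable-2 (l ⁺)
    ... | inj₂ q = q
    ... | inj₁ q with comparable-3 l
    ...   | inj₂ r = contradiction (<-trans r q) (∼⇒≮ (∼-step l))
    ...   | inj₁ r = contradiction (<-trans r p) (∼⇒≯ (∼-step (l ⁺ ⁺)))

    <-2-backward : ∀ l → x (l ⁺) < x (l ⁺ ⁺ ⁺) → x l < x (l ⁺ ⁺)
    <-2-backward l q with comparable-2 l
    ... | inj₂ p = p
    ... | inj₁ p with comparable-3 l
    ...   | inj₂ r = contradiction (<-trans p r) (∼⇒≮ (∼-step (l ⁺ ⁺)))
    ...   | inj₁ r = contradiction (<-trans q r) (∼⇒≯ (∼-step l))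

    module _ (x₀<x₂ : x (+ 0) < x (+ 2)) where

      <-2 : ∀ l → x l < x (l ⁺ ⁺)
      <-2 = ⁺-invariant⇒universal (λ l → x l < x (l ⁺ ⁺)) <-2-forward <-2-backward x₀<x₂

      <-3 : ∀ l → x l < x (l ⁺ ⁺ ⁺)
      <-3 l with comparable-3 l
      ... | inj₂ r = r
      ... | inj₁ r = contradiction (<-trans (<-2 (l ⁺)) r) (∼⇒≯ (∼-step l))

      <-⁺^[2+d] : ∀ d l → x l < x (l ⁺^ suc (suc d))
      <-⁺^[2+d] zero          l = <-2 l
      <-⁺^[2+d] (suc zero)    l = <-3 l
      <-⁺^[2+d] (suc (suc d)) l = <-trans (<-2 l) (<-⁺^[2+d] d (l ⁺ ⁺))

      <-at-distance≥2 : ∀ l m → l + + 2 ≤ m → x l < x m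
      <-at-distance≥2 l m l+2≤m = subst (λ k → x l < x k) l⁺^[2+d]≡m (<-⁺^[2+d] d l)
        where
        open ≡-Reasoning
        d = ∣ m - (l + + 2) ∣
        l⁺^[2+d]≡m : l ⁺^ suc (suc d) ≡ m
        l⁺^[2+d]≡m = begin
          l ⁺ ⁺ ⁺^ d     ≡⟨ ⁺^≡+ (l ⁺ ⁺) d ⟩
          l ⁺ ⁺ + + d    ≡⟨ cong (λ k → k + + d) (+-assoc l (+ 1) (+ 1)) ⟩
          l + + 2 + + d  ≡⟨ i≤j⇒i+∣j-i∣≡j l+2≤m ⟩
          m              ∎

  module _ (model : ModelΦ) where
    private
      exactly-one = proj₁ model
      far-comparable = proj₁ (proj₂ (proj₂ model))

    class-unique : ∀ {i j x} → A i x → A j x → i ≡ j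
    class-unique {x = x} Aix Ajx with exactly-one x
    ... | _ , _ , only = trans (only _ Aix) (sym (only _ Ajx))

    right-witness-class : ∀ {i x y} → RightWitness x y → A i x → A (succ5 i) y
    right-witness-class {y = y} (j , Ajx , Aj⁺y , _) Aix =
      subst (λ k → A (succ5 k) y) (class-unique Ajx Aix) Aj⁺y

    comparable-distance-2 : ∀ i {x y} → A i x → A (succ5 (succ5 i)) y → Comparable x y
    comparable-distance-2 zero                            Ax Ay = far-comparable zero _ (inj₁ refl) _ _ Ax Ay
    comparable-distance-2 (suc zero)                      Ax Ay = far-comparable (suc zero) _ (inj₁ refl) _ _ Ax Ay
    comparable-distance-2 (suc (suc zero))                Ax Ay = far-comparable (suc (suc zero)) _ (inj₁ refl) _ _ Ax Ay
    comparable-distance-2 (suc (suc (suc zero)))          Ax Ay = swap (far-comparable zero _ (inj₂ refl) _ _ Ay Ax)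
    comparable-distance-2 (suc (suc (suc (suc zero))))    Ax Ay = swap (far-comparable (suc zero) _ (inj₂ refl) _ _ Ay Ax)

    comparable-distance-3 : ∀ i {x y} → A i x → A (succ5 (succ5 (succ5 i))) y → Comparable x y
    comparable-distance-3 zero                            Ax Ay = far-comparable zero _ (inj₂ refl) _ _ Ax Ay
    comparable-distance-3 (suc zero)                      Ax Ay = far-comparable (suc zero) _ (inj₂ refl) _ _ Ax Ay
    comparable-distance-3 (suc (suc zero))                Ax Ay = far-comparable (suc (suc zero)) _ (inj₂ refl) _ _ Ax Ay
    comparable-distance-3 (suc (suc (suc zero)))          Ax Ay = swap (far-comparable (suc zero) _ (inj₁ refl) _ _ Ay Ax)
    comparable-distance-3 (suc (suc (suc (suc zero))))    Ax Ay = swap (far-comparable (suc (suc zero)) _ (inj₁ refl) _ _ Ay Ax)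

    module _ {a : ℤ → Carrier} (chain : QuasiChain a) where

      chain-∼ : ∀ l → a l ∼ a (l ⁺)
      chain-∼ l = proj₂ (proj₂ (proj₂ (chain l)))

      chain-comparable-2 : ∀ l → Comparable (a l) (a (l ⁺ ⁺))
      chain-comparable-2 l with chain l
      ... | i , Ail , Ai⁺l⁺ , _ = comparable-distance-2 i Ail
        (right-witness-class (chain (l ⁺)) Ai⁺l⁺)

      chain-comparable-3 : ∀ l → Comparable (a l) (a (l ⁺ ⁺ ⁺))
      chain-comparable-3 l with chain l
      ... | i , Ail , Ai⁺l⁺ , _ = comparable-distance-3 i Ail
        (right-witness-class (chain (l ⁺ ⁺)) (right-witness-class (chain (l ⁺)) Ai⁺l⁺))

claim5p1 : ∀ {c ℓ} (𝔄 : Structure c ℓ) → Structure.ModelΦ 𝔄 →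
           (a : ℤ → Structure.Carrier 𝔄) → Structure.QuasiChain 𝔄 a →
           Structure._<_ 𝔄 (a (+ 0)) (a (+ 2)) →
           ∀ l m → l + + 2 ≤ m → Structure._<_ 𝔄 (a l) (a m)
claim5p1 𝔄 model a chain a₀<a₂ =
  <-at-distance≥2 𝔄 a (chain-∼ 𝔄 model chain)
    (chain-comparable-2 𝔄 model chain) (chain-comparable-3 𝔄 model chain) a₀<a₂
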